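{- Let $r\geq3$ and $n\ge1$. If $r$ is odd, then $$\det(1;T_1^{(r)},T_3^{(r)},\ldots,T_{2n-1}^{(r)})=(-1)^{n-1}a_n,$$ where $a_n=0$ for $1\le n<\frac{r+1}{2}$, $a_n=F_{2n-r+1}$ for $\frac{r+1}{2}\le n<r$, $a_r=1+F_{r+1}$, and $a_n=3a_{n-1}-a_{n-2}+a_{n-\frac{r+1}{2}}$ for $n\geq r+1$. If $r$ is even, then $$\det(1;T_1^{(r)},T_3^{(r)},\ldots,T_{2n-1}^{(r)})=(-1)^{n-1}b_n,$$ where $b_n=0$ for $1\le n<\frac r2$, $b_n=F_{2n-r+1}$ for $\frac r2\le n\le r$, and $b_n=3b_{n-1}-b_{n-2}+b_{n-\frac r2}-b_{n-\frac r2-1}$ for $n\geq r+1$.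
   Context: For $r\ge3$, the generalized $r$-tribonacci numbers are defined by $T_0^{(r)}=\cdots=T_{r-2}^{(r)}=0$, $T_{r-1}^{(r)}=1$, and $T_n^{(r)}=T_{n-1}^{(r)}+T_{n-2}^{(r)}+T_{n-r}^{(r)}$ for $n\geq r$. $F_n$ are the Fibonacci numbers ($F_0=0$, $F_1=1$, $F_n=F_{n-1}+F_{n-2}$). For numbers $a_0,\ldots,a_n$, $\det(a_0;a_1,\ldots,a_n)$ denotes the determinant of the $n\times n$ Toeplitz--Hessenberg matrix whose $(i,j)$ entry is $a_{i-j+1}$ if $i-j+1\ge0$ and $0$ otherwise; here the $k$-th entry after the semicolon is $T_{2k-1}^{(r)}$. -}

module Defs where

open import Data.Nat as ℕ using (ℕ; zero; suc; _∸_; _<?_; _≤?_; _/_)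
open import Data.Integer as ℤ using (ℤ; +_; -_; _*_; _+_; _-_; _^_)
open import Data.Fin using (Fin; zero; suc; toℕ; punchIn)
open import Relation.Nullary using (yes; no)

fib : ℕ → ℕ
fib 0 = 0
fib 1 = 1
fib (suc (suc n)) = fib (suc n) ℕ.+ fib n

-- generalized r-tribonacci numbers, computed with a fuel argument
-- (fuel n+1 suffices since all recursive indices are strictly smaller)
tribAux : ℕ → ℕ → ℕ → ℕ
tribAux r zero n = 0
tribAux r (suc f) n with n <? r ∸ 1
... | yes _ = 0
... | no _ with n ℕ.≟ r ∸ 1
...   | yes _ = 1
...   | no _ = tribAux r f (n ∸ 1) ℕ.+ tribAux r f (n ∸ 2) ℕ.+ tribAux r f (n ∸ r)

T : ℕ → ℕ → ℕ
T r n = tribAux r (suc n) n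

sumFin : ∀ n → (Fin n → ℤ) → ℤ
sumFin zero f = + 0
sumFin (suc n) f = f zero + sumFin n (λ i → f (suc i))

det : ∀ n → (Fin n → Fin n → ℤ) → ℤ
det zero M = + 1
det (suc n) M =
  sumFin (suc n) (λ j → ((- + 1) ^ toℕ j) * (M zero j * det n (λ i k → M (suc i) (punchIn j k))))

-- Toeplitz–Hessenberg matrix of (a₀; a₁, …, aₙ): entry (i,j) is a_{i-j+1}
-- if i-j+1 ≥ 0 and 0 otherwise (0-indexed rows/columns, same difference)
toeplitzHessenberg : ∀ n → (ℕ → ℤ) → Fin n → Fin n → ℤ
toeplitzHessenberg n a i j with toℕ j ≤? suc (toℕ i)
... | yes _ = a (suc (toℕ i) ∸ toℕ j)
... | no _ = + 0

detTH : ∀ n → (ℕ → ℤ) → ℤ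
detTH n a = det n (toeplitzHessenberg n a)

oddTribSeq : ℕ → ℕ → ℤ
oddTribSeq r zero = + 1
oddTribSeq r (suc k) = + T r (2 ℕ.* k ℕ.+ 1)

aAux : ℕ → ℕ → ℕ → ℤ
aAux r zero n = + 0
aAux r (suc f) n with n <? (r ℕ.+ 1) / 2
... | yes _ = + 0
... | no _ with n <? r
...   | yes _ = + fib (2 ℕ.* n ∸ r ℕ.+ 1)
...   | no _ with n ℕ.≟ r
...     | yes _ = + 1 + + fib (r ℕ.+ 1)
...     | no _ = + 3 * aAux r f (n ∸ 1) - aAux r f (n ∸ 2) + aAux r f (n ∸ (r ℕ.+ 1) / 2)

aSeq : ℕ → ℕ → ℤ
aSeq r n = aAux r (suc n) n

bAux : ℕ → ℕ → ℕ → ℤ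
bAux r zero n = + 0
bAux r (suc f) n with n <? r / 2
... | yes _ = + 0
... | no _ with n ≤? r
...   | yes _ = + fib (2 ℕ.* n ∸ r ℕ.+ 1)
...   | no _ = + 3 * bAux r f (n ∸ 1) - bAux r f (n ∸ 2)
                 + bAux r f (n ∸ r / 2) - bAux r f (n ∸ r / 2 ∸ 1)

bSeq : ℕ → ℕ → ℤ
bSeq r n = bAux r (suc n) n

module Submission where

-- Write s = (1, T₁, T₃, T₅, …) and let a be the claimed sequence (aSeq r for
-- odd r, bSeq r for even r); S and A denote their generating functions.
--  1. A Toeplitz–Hessenberg determinant with a₀ = 1 satisfies the first-row
--     recursion D_{m+1} = Σ_{k≤m} (-1)^k s_{k+1} D_{m-k}.  Hence (Trudi) if
--     S · (1 - A) = 1, i.e. s_{m+1} = a_{m+1} + Σ_{k<m} s_{k+1} a_{m-k}, then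
--     D_{m+1} = (-1)^m a_{m+1}                            (detTH-closedForm).
--  2. S · (1 - A) = 1 follows without division from (1 + P) A = N and
--     (1 + P - N) S = 1 + P for shift polynomials P, N without constant term
--     (InverseSeries).  Sequences are extended by zero to ℤ, so that shifts
--     need no boundary cases.
--  3. (1 + P - N) S = 1 + P: s_m = t_{2m-1} + δ_m, and multiplying the
--     tribonacci recurrence 1 - E - E² - E^r by 1 + E - E² ± E^r leaves only
--     even shifts                       (Tribonacci, OddSequence, EvenSequence).
--  4. (1 + P) A = N: the piecewise definition of a is checked range by range,
--     using F_{k+4} = 3F_{k+2} - F_k              (OddRecurrence, EvenRecurrence).

open import Defs
open import Data.Nat as ℕ using (ℕ; zero; suc; _≤_; _<_; _%_; _∸_; _/_; z≤n; s≤s; _<?_; _≤?_)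
import Data.Nat.Properties as ℕP
import Data.Nat.Tactic.RingSolver as ℕ-Solver
open import Data.Nat.Induction using (<-rec)
open import Data.Nat.DivMod using (m*n/n≡m; m≡m%n+[m/n]*n)
open import Data.Integer as ℤ using (ℤ; +_; -[1+_]; -_; _*_; _+_; _-_; _^_; _⊖_)
import Data.Integer.Properties as ℤP
open import Data.Integer.Tactic.RingSolver using (solve-∀; solve)
open import Data.Fin using (Fin; zero; suc; toℕ; punchIn)
open import Data.List using (List; []; _∷_)
open import Data.Product using (_×_; _,_; ∃-syntax)
open import Function using (_∘_)
open import Relation.Nullary using (yes; no; contradiction)
open import Relation.Binary.PropositionalEquality
open import Relation.Binary.Definitions using (tri<; tri≈; tri>)
open ≡-Reasoning

sum< : ℕ → (ℕ → ℤ) → ℤ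
sum< zero    f = + 0
sum< (suc n) f = f 0 + sum< n (f ∘ suc)

sum<-last : ∀ n f → sum< (suc n) f ≡ sum< n f + f n
sum<-last zero    f = trans (ℤP.+-identityʳ (f 0)) (sym (ℤP.+-identityˡ (f 0)))
sum<-last (suc n) f = trans (cong (λ x → f 0 + x) (sum<-last n (f ∘ suc))) (sym (ℤP.+-assoc (f 0) _ _))

sum<-cong : ∀ n {f g} → (∀ k → k < n → f k ≡ g k) → sum< n f ≡ sum< n g
sum<-cong zero    f≗g = refl
sum<-cong (suc n) f≗g = cong₂ _+_ (f≗g 0 (s≤s z≤n)) (sum<-cong n (λ k k<n → f≗g (suc k) (s≤s k<n)))

sum<-*ˡ : ∀ n c f → sum< n (λ k → c * f k) ≡ c * sum< n f
sum<-*ˡ zero    c f = sym (ℤP.*-zeroʳ c)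
sum<-*ˡ (suc n) c f =
  trans (cong (λ x → c * f 0 + x) (sum<-*ˡ n c (f ∘ suc))) (sym (ℤP.*-distribˡ-+ c (f 0) _))

sum<-+ : ∀ n f g → sum< n (λ k → f k + g k) ≡ sum< n f + sum< n g
sum<-+ zero    f g = refl
sum<-+ (suc n) f g =
  trans (cong (λ x → f 0 + g 0 + x) (sum<-+ n (f ∘ suc) (g ∘ suc))) (interchange (f 0) (g 0) _ _)
  where
  interchange : ∀ a b c d → a + b + (c + d) ≡ a + c + (b + d)
  interchange = solve-∀

sum<-zero : ∀ n f → (∀ k → f k ≡ + 0) → sum< n f ≡ + 0
sum<-zero zero    f f≗0 = refl
sum<-zero (suc n) f f≗0 = cong₂ _+_ (f≗0 0) (sum<-zero n (f ∘ suc) (f≗0 ∘ suc))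

sum<-split : ∀ p d f → sum< (p ℕ.+ d) f ≡ sum< p f + sum< d (λ k → f (p ℕ.+ k))
sum<-split zero    d f = sym (ℤP.+-identityˡ _)
sum<-split (suc p) d f =
  trans (cong (λ x → f 0 + x) (sum<-split p d (f ∘ suc))) (sym (ℤP.+-assoc (f 0) _ _))

sumFin-cong : ∀ n {f g : Fin n → ℤ} → (∀ i → f i ≡ g i) → sumFin n f ≡ sumFin n g
sumFin-cong zero    f≗g = refl
sumFin-cong (suc n) f≗g = cong₂ _+_ (f≗g zero) (sumFin-cong n (f≗g ∘ suc))

sumFin-zero : ∀ n (f : Fin n → ℤ) → (∀ i → f i ≡ + 0) → sumFin n f ≡ + 0
sumFin-zero zero    f f≗0 = refl
sumFin-zero (suc n) f f≗0 = cong₂ _+_ (f≗0 zero) (sumFin-zero n (f ∘ suc) (f≗0 ∘ suc))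

det-cong : ∀ n {M N : Fin n → Fin n → ℤ} → (∀ i j → M i j ≡ N i j) → det n M ≡ det n N
det-cong zero    M≗N = refl
det-cong (suc n) M≗N = sumFin-cong (suc n) λ j →
  cong₂ (λ x y → ((- + 1) ^ toℕ j) * (x * y)) (M≗N zero j)
        (det-cong n (λ i k → M≗N (suc i) (punchIn j k)))

entry : (ℕ → ℤ) → ℕ → ℕ → ℤ
entry a i j with j ≤? suc i
... | yes _ = a (suc i ∸ j)
... | no  _ = + 0

toeplitzHessenberg-entry : ∀ n a (i j : Fin n) → toeplitzHessenberg n a i j ≡ entry a (toℕ i) (toℕ j)
toeplitzHessenberg-entry n a i j with toℕ j ≤? suc (toℕ i)
... | yes _ = refl
... | no  _ = refl

entry-shift : ∀ a i j → entry a (suc i) (suc j) ≡ entry a i j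
entry-shift a i j with j ≤? suc i | suc j ≤? suc (suc i)
... | yes _   | yes _    = refl
... | no  _   | no  _    = refl
... | yes j≤  | no  sj≰  = contradiction (s≤s j≤) sj≰
... | no  j≰  | yes sj≤  = contradiction (ℕP.≤-pred sj≤) j≰

-- Expanding along the first row reproduces the same shape one size smaller,
-- which is why this generalisation is the right induction hypothesis.
withFirstColumn : ∀ n → (ℕ → ℤ) → (ℕ → ℤ) → Fin n → Fin n → ℤ
withFirstColumn n b a i zero    = b (toℕ i)
withFirstColumn n b a i (suc j) = entry a (toℕ i) (suc (toℕ j))

-- First-row expansion: the first row is (b 0, a 0, 0, …, 0) and a 0 = 1.
det-withFirstColumn-step : ∀ n b a → a 0 ≡ + 1 →
  det (suc (suc n)) (withFirstColumn (suc (suc n)) b a)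
    ≡ b 0 * detTH (suc n) a - det (suc n) (withFirstColumn (suc n) (b ∘ suc) a)
det-withFirstColumn-step n b a a₀≡1 = begin
    det (suc (suc n)) M
  ≡⟨⟩
    + 1 * (b 0 * det (suc n) (minor zero))
      + ((- + 1 * + 1) * (a 0 * det (suc n) (minor (suc zero))) + sumFin n farTerms)
  ≡⟨ cong₂ (λ x y → + 1 * (b 0 * x) + ((- + 1 * + 1) * y + sumFin n farTerms))
           (det-cong (suc n) minor₀≗TH)
           (cong₂ _*_ a₀≡1 (det-cong (suc n) minor₁≗M′)) ⟩
    + 1 * (b 0 * detTH (suc n) a) + ((- + 1 * + 1) * (+ 1 * G) + sumFin n farTerms)
  ≡⟨ cong (λ x → + 1 * (b 0 * detTH (suc n) a) + ((- + 1 * + 1) * (+ 1 * G) + x))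
          (sumFin-zero n farTerms (λ j → ℤP.*-zeroʳ ((- + 1) ^ suc (suc (toℕ j))))) ⟩
    + 1 * (b 0 * detTH (suc n) a) + ((- + 1 * + 1) * (+ 1 * G) + + 0)
  ≡⟨ collect (b 0) (detTH (suc n) a) G ⟩
    b 0 * detTH (suc n) a - G
  ∎
  where
  M = withFirstColumn (suc (suc n)) b a
  minor : Fin (suc (suc n)) → Fin (suc n) → Fin (suc n) → ℤ
  minor j i k = M (suc i) (punchIn j k)
  G = det (suc n) (withFirstColumn (suc n) (b ∘ suc) a)
  farTerms : Fin n → ℤ
  farTerms j = ((- + 1) ^ toℕ (suc (suc j))) * (M zero (suc (suc j)) * det (suc n) (minor (suc (suc j))))
  minor₀≗TH : ∀ i k → minor zero i k ≡ toeplitzHessenberg (suc n) a i k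
  minor₀≗TH i k = trans (entry-shift a (toℕ i) (toℕ k)) (sym (toeplitzHessenberg-entry (suc n) a i k))
  minor₁≗M′ : ∀ i k → minor (suc zero) i k ≡ withFirstColumn (suc n) (b ∘ suc) a i k
  minor₁≗M′ i zero    = refl
  minor₁≗M′ i (suc k) = entry-shift a (toℕ i) (suc (toℕ k))
  collect : ∀ x d g → + 1 * (x * d) + ((- + 1 * + 1) * (+ 1 * g) + + 0) ≡ x * d - g
  collect = solve-∀

sgn : ℕ → ℤ
sgn k = (- + 1) ^ k

det-withFirstColumn : ∀ a → a 0 ≡ + 1 → ∀ m b →
  det (suc m) (withFirstColumn (suc m) b a)
    ≡ sum< (suc m) (λ k → sgn k * (b k * detTH (m ∸ k) a))
det-withFirstColumn a a₀≡1 zero    b = refl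
det-withFirstColumn a a₀≡1 (suc m) b = begin
    det (suc (suc m)) (withFirstColumn (suc (suc m)) b a)
  ≡⟨ det-withFirstColumn-step m b a a₀≡1 ⟩
    b 0 * D - det (suc m) (withFirstColumn (suc m) (b ∘ suc) a)
  ≡⟨ cong (λ x → b 0 * D - x) (det-withFirstColumn a a₀≡1 m (b ∘ suc)) ⟩
    b 0 * D - sum< (suc m) tail
  ≡⟨ split (b 0 * D) (sum< (suc m) tail) ⟩
    + 1 * (b 0 * D) + - + 1 * sum< (suc m) tail
  ≡⟨ cong (λ x → + 1 * (b 0 * D) + x) (sym (sum<-*ˡ (suc m) (- + 1) tail)) ⟩
    + 1 * (b 0 * D) + sum< (suc m) (λ k → - + 1 * tail k)
  ≡⟨ cong (λ x → + 1 * (b 0 * D) + x)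
          (sum<-cong (suc m) {g = λ k → sgn (suc k) * (b (suc k) * detTH (m ∸ k) a)}
                     (λ k _ → sym (ℤP.*-assoc (- + 1) (sgn k) _))) ⟩
    sum< (suc (suc m)) (λ k → sgn k * (b k * detTH (suc m ∸ k) a))
  ∎
  where
  D = detTH (suc m) a
  tail : ℕ → ℤ
  tail k = sgn k * (b (suc k) * detTH (m ∸ k) a)
  split : ∀ x y → x - y ≡ + 1 * x + - + 1 * y
  split = solve-∀

detTH-expansion : ∀ a → a 0 ≡ + 1 → ∀ m →
  detTH (suc m) a ≡ sum< (suc m) (λ k → sgn k * (a (suc k) * detTH (m ∸ k) a))
detTH-expansion a a₀≡1 m =
  trans (det-cong (suc m) sameMatrix) (det-withFirstColumn a a₀≡1 m (a ∘ suc))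
  where
  sameMatrix : ∀ i j → toeplitzHessenberg (suc m) a i j ≡ withFirstColumn (suc m) (a ∘ suc) a i j
  sameMatrix i zero    = toeplitzHessenberg-entry (suc m) a i zero
  sameMatrix i (suc j) = toeplitzHessenberg-entry (suc m) a i (suc j)

sgn-product : ∀ k j → sgn k * sgn j ≡ - sgn (k ℕ.+ suc j)
sgn-product k j = begin
    sgn k * sgn j                  ≡⟨ flip (sgn k) (sgn j) ⟩
    - (sgn k * (- + 1 * sgn j))    ≡⟨ cong -_ (sym (ℤP.^-distribˡ-+-* (- + 1) k (suc j))) ⟩
    - sgn (k ℕ.+ suc j)            ∎
  where
  flip : ∀ x y → x * y ≡ - (x * (- + 1 * y))
  flip = solve-∀

-- If s₀ = 1 and A is the sequence with
-- s = 1 + s·A as power series, i.e.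
--   s_{m+1} = A_{m+1} + Σ_{k<m} s_{k+1} A_{m-k},
-- then det(1; s₁, …, s_{m+1}) = (-1)^m A_{m+1}.  The expansion above turns
-- into exactly this convolution once the smaller determinants are known.
detTH-closedForm : ∀ (s A : ℕ → ℤ) → s 0 ≡ + 1 →
  (∀ m → s (suc m) ≡ A (suc m) + sum< m (λ k → s (suc k) * A (m ∸ k))) →
  ∀ m → detTH (suc m) s ≡ sgn m * A (suc m)
detTH-closedForm s A s₀≡1 conv = <-rec ClosedForm step
  where
  ClosedForm : ℕ → Set
  ClosedForm m = detTH (suc m) s ≡ sgn m * A (suc m)

  step : ∀ m → (∀ {p} → p < m → ClosedForm p) → ClosedForm m
  step m ih = begin
      detTH (suc m) s
    ≡⟨ detTH-expansion s s₀≡1 m ⟩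
      sum< (suc m) term
    ≡⟨ sum<-last m term ⟩
      sum< m term + term m
    ≡⟨ cong₂ _+_ (sum<-cong m earlyTerm) (cong (λ i → sgn m * (s (suc m) * detTH i s)) (ℕP.n∸n≡0 m)) ⟩
      sum< m (λ k → - sgn m * g k) + sgn m * (s (suc m) * + 1)
    ≡⟨ cong (λ x → x + sgn m * (s (suc m) * + 1)) (sum<-*ˡ m (- sgn m) g) ⟩
      - sgn m * sum< m g + sgn m * (s (suc m) * + 1)
    ≡⟨ cong (λ y → - sgn m * sum< m g + sgn m * (y * + 1)) (conv m) ⟩
      - sgn m * sum< m g + sgn m * ((A (suc m) + sum< m g) * + 1)
    ≡⟨ cancel (sgn m) (sum< m g) (A (suc m)) ⟩
      sgn m * A (suc m)
    ∎
    where
    term : ℕ → ℤ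
    term k = sgn k * (s (suc k) * detTH (m ∸ k) s)
    g : ℕ → ℤ
    g k = s (suc k) * A (m ∸ k)
    cancel : ∀ e S a → - e * S + e * ((a + S) * + 1) ≡ e * a
    cancel = solve-∀
    reassoc : ∀ e x f y → e * (x * (f * y)) ≡ (e * f) * (x * y)
    reassoc = solve-∀
    earlyTerm : ∀ k → k < m → term k ≡ - sgn m * g k
    earlyTerm k k<m = begin
        sgn k * (s (suc k) * detTH (m ∸ k) s)
      ≡⟨ cong (λ i → sgn k * (s (suc k) * detTH i s)) m∸k≡1+j ⟩
        sgn k * (s (suc k) * detTH (suc j) s)
      ≡⟨ cong (λ x → sgn k * (s (suc k) * x)) (ih (subst (_≤ m) m∸k≡1+j (ℕP.m∸n≤m m k))) ⟩
        sgn k * (s (suc k) * (sgn j * A (suc j)))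
      ≡⟨ reassoc (sgn k) (s (suc k)) (sgn j) (A (suc j)) ⟩
        (sgn k * sgn j) * (s (suc k) * A (suc j))
      ≡⟨ cong₂ (λ e i → e * (s (suc k) * A i))
               (trans (sgn-product k j) (cong (λ i → - sgn i) k+1+j≡m)) (sym m∸k≡1+j) ⟩
        - sgn m * g k
      ∎
      where
      j = m ∸ suc k
      m∸k≡1+j : m ∸ k ≡ suc j
      m∸k≡1+j = ℕP.+-∸-assoc 1 k<m
      k+1+j≡m : k ℕ.+ suc j ≡ m
      k+1+j≡m = trans (ℕP.+-suc k j) (ℕP.m+[n∸m]≡n k<m)

extend : (ℕ → ℤ) → ℤ → ℤ
extend f (+ n)    = f n
extend f -[1+ n ] = + 0

δ : ℤ → ℤ
δ (+ zero)    = + 1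
δ (+ suc _)   = + 0
δ -[1+ _ ]    = + 0

-- A strictly causal shift operator  f ↦ Σ c · f(m - (j+1)), given by its
-- list of pairs (c , j).  In generating-function language this is
-- multiplication by the polynomial Σ c x^(j+1), which has no constant term.
Operator : Set
Operator = List (ℤ × ℕ)

apply : Operator → (ℤ → ℤ) → ℤ → ℤ
apply []            f m = + 0
apply ((c , j) ∷ P) f m = c * f (m - + suc j) + apply P f m

apply-− : ∀ P f g m → apply P (λ x → f x - g x) m ≡ apply P f m - apply P g m
apply-− []            f g m = refl
apply-− ((c , j) ∷ P) f g m =
  trans (cong (λ x → c * (f m′ - g m′) + x) (apply-− P f g m))
        (distrib c (f m′) (g m′) (apply P f m) (apply P g m))
  where
  m′ = m - + suc j
  distrib : ∀ c x y u v → c * (x - y) + (u - v) ≡ c * x + u - (c * y + v)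
  distrib = solve-∀

apply-causal : ∀ P n f g → (∀ m → m ℤ.< + n → f m ≡ g m) → apply P f (+ n) ≡ apply P g (+ n)
apply-causal []            n f g f≗g = refl
apply-causal ((c , j) ∷ P) n f g f≗g =
  cong₂ (λ x y → c * x + y) (f≗g (n ⊖ suc j) (ℤP.m⊖1+n<m n (suc j))) (apply-causal P n f g f≗g)

apply-convolve : ∀ P n (s : ℕ → ℤ) g m →
  sum< n (λ k → s k * apply P g (m - + k)) ≡ apply P (λ m′ → sum< n (λ k → s k * g (m′ - + k))) m
apply-convolve []            n s g m = sum<-zero n _ (λ k → ℤP.*-zeroʳ (s k))
apply-convolve ((c , j) ∷ P) n s g m = begin
    sum< n (λ k → s k * (c * g (m - + k - + suc j) + apply P g (m - + k)))
  ≡⟨ sum<-cong n (λ k _ → trans (cong (λ x → s k * (c * g x + apply P g (m - + k))) (swap m (+ k) (+ suc j)))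
                                 (distrib (s k) c _ _)) ⟩
    sum< n (λ k → c * (s k * g (m - + suc j - + k)) + s k * apply P g (m - + k))
  ≡⟨ sum<-+ n _ _ ⟩
    sum< n (λ k → c * (s k * g (m - + suc j - + k))) + sum< n (λ k → s k * apply P g (m - + k))
  ≡⟨ cong₂ _+_ (sum<-*ˡ n c _) (apply-convolve P n s g m) ⟩
    c * sum< n (λ k → s k * g (m - + suc j - + k)) + apply P (λ m′ → sum< n (λ k → s k * g (m′ - + k))) m
  ∎
  where
  swap : ∀ m k j → m - k - j ≡ m - j - k
  swap = solve-∀
  distrib : ∀ s c x y → s * (c * x + y) ≡ c * (s * x) + s * y
  distrib = solve-∀

convolve-δ : ∀ n f m → m ℤ.< + n → sum< n (λ k → f k * δ (m - + k)) ≡ extend f m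
convolve-δ zero    f -[1+ p ] _      = refl
convolve-δ zero    f (+ p)    (ℤ.+<+ ())
convolve-δ (suc n) f m        m<1+n = begin
    f 0 * δ (m - + 0) + sum< n (λ k → f (suc k) * δ (m - + suc k))
  ≡⟨ cong₂ _+_ (cong (λ x → f 0 * δ x) (ℤP.+-identityʳ m))
               (sum<-cong n (λ k _ → cong (λ x → f (suc k) * δ x) (sub-suc m k))) ⟩
    f 0 * δ m + sum< n (λ k → f (suc k) * δ (m - + 1 - + k))
  ≡⟨ cong (λ x → f 0 * δ m + x) (convolve-δ n (f ∘ suc) (m - + 1) (pred-bound m m<1+n)) ⟩
    f 0 * δ m + extend (f ∘ suc) (m - + 1)
  ≡⟨ peel m ⟩
    extend f m
  ∎
  where
  sub-suc : ∀ m k → m - + suc k ≡ m - + 1 - + k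
  sub-suc m k = reorder m (+ k)
    where
    reorder : ∀ m k → m - (+ 1 + k) ≡ m - + 1 - k
    reorder = solve-∀
  pred-bound : ∀ m → m ℤ.< + suc n → m - + 1 ℤ.< + n
  pred-bound (+ zero)  _                  = ℤ.-<+
  pred-bound (+ suc p) (ℤ.+<+ (s≤s p<n)) = ℤ.+<+ p<n
  pred-bound -[1+ p ]  _                  = ℤ.-<+
  peel : ∀ m → f 0 * δ m + extend (f ∘ suc) (m - + 1) ≡ extend f m
  peel (+ zero)  = trans (ℤP.+-identityʳ _) (ℤP.*-identityʳ (f 0))
  peel (+ suc p) = trans (cong (_+ f (suc p)) (ℤP.*-zeroʳ (f 0))) (ℤP.+-identityˡ _)
  peel -[1+ p ]  = trans (ℤP.+-identityʳ _) (ℤP.*-zeroʳ (f 0))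

minus-≤ : ∀ {n k} → k ≤ n → + n - + k ≡ + (n ∸ k)
minus-≤ {n} {k} k≤n = trans (ℤP.m-n≡m⊖n n k) (ℤP.⊖-≥ k≤n)

negative-shift : ∀ q k → -[1+ q ] - + k ≡ -[1+ (q ℕ.+ k) ]
negative-shift q zero    = trans (ℤP.+-identityʳ _) (cong -[1+_] (sym (ℕP.+-identityʳ q)))
negative-shift q (suc k) = cong -[1+_] (sym (ℕP.+-suc q k))

minus-suc : ∀ n j → + suc n - + suc j ≡ + n - + j
minus-suc n j = trans (ℤP.[1+m]⊖[1+n]≡m⊖n n j) (sym (ℤP.m-n≡m⊖n n j))

δ-minus-self : ∀ n → δ (+ n - + n) ≡ + 1
δ-minus-self zero    = refl
δ-minus-self (suc n) = trans (cong δ (minus-suc n n)) (δ-minus-self n)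

δ-minus-≢ : ∀ n j → n ≢ j → δ (+ n - + j) ≡ + 0
δ-minus-≢ zero    zero    n≢j = contradiction refl n≢j
δ-minus-≢ zero    (suc j) _   = refl
δ-minus-≢ (suc n) zero    _   = refl
δ-minus-≢ (suc n) (suc j) n≢j = trans (cong δ (minus-suc n j)) (δ-minus-≢ n j (n≢j ∘ cong suc))

extend-minus : ∀ f → f 0 ≡ + 0 → ∀ n j → extend f (+ n - + j) ≡ f (n ∸ j)
extend-minus f f₀≡0 n       zero    = cong (extend f) (ℤP.+-identityʳ (+ n))
extend-minus f f₀≡0 zero    (suc j) = sym f₀≡0
extend-minus f f₀≡0 (suc n) (suc j) = trans (cong (extend f) (minus-suc n j)) (extend-minus f f₀≡0 n j)

minus-minus : ∀ x k j → x - + k - + j ≡ x - + (k ℕ.+ j)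
minus-minus x k j = regroup x (+ k) (+ j)
  where
  regroup : ∀ x k j → x - k - j ≡ x - (k + j)
  regroup = solve-∀

-- Let s₀ = 1, a₀ = 0, and read the
-- operators P, N as polynomials without constant term.  If the generating
-- functions S, A satisfy
--   (1 + P) A = N            (a-rec)
--   (1 + P - N) S = 1 + P    (s-rec)
-- then A = N/(1+P), S = (1+P)/(1+P-N), hence S · (1 - A) = 1, which is the
-- convolution identity s_{n+1} = a_{n+1} + Σ_{k<n} s_{k+1} a_{n-k}.
-- Division is avoided: W = s - s⋆a satisfies (1+P) W = (1+P) δ, and since
-- P is strictly causal this forces W = δ by strong induction.
module InverseSeries (s a : ℕ → ℤ) (s₀≡1 : s 0 ≡ + 1) (a₀≡0 : a 0 ≡ + 0) (P N : Operator)
  (a-rec : ∀ m → extend a m + apply P (extend a) m ≡ apply N δ m)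
  (s-rec : ∀ m → extend s m + apply P (extend s) m - apply N (extend s) m ≡ δ m + apply P δ m)
  where

  conv< : ℕ → ℤ → ℤ
  conv< n m = sum< n (λ k → s k * extend a (m - + k))

  -- (1+P)(s⋆a) = s⋆((1+P) a) = s⋆(N δ) = N (s⋆δ).
  conv<-rec : ∀ n m →
    conv< n m + apply P (conv< n) m ≡ apply N (λ m′ → sum< n (λ k → s k * δ (m′ - + k))) m
  conv<-rec n m = begin
      conv< n m + apply P (conv< n) m
    ≡⟨ cong (λ x → conv< n m + x) (sym (apply-convolve P n s (extend a) m)) ⟩
      conv< n m + sum< n (λ k → s k * apply P (extend a) (m - + k))
    ≡⟨ sym (sum<-+ n _ _) ⟩
      sum< n (λ k → s k * extend a (m - + k) + s k * apply P (extend a) (m - + k))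
    ≡⟨ sum<-cong n (λ k _ → trans (sym (ℤP.*-distribˡ-+ (s k) _ _)) (cong (s k *_) (a-rec (m - + k)))) ⟩
      sum< n (λ k → s k * apply N δ (m - + k))
    ≡⟨ apply-convolve N n s δ m ⟩
      apply N (λ m′ → sum< n (λ k → s k * δ (m′ - + k))) m
    ∎

  -- Since a vanishes at 0 and below, terms with k ≥ p do not contribute at p.
  extend-a-nonpositive : ∀ k → extend a (- + k) ≡ + 0
  extend-a-nonpositive zero    = a₀≡0
  extend-a-nonpositive (suc k) = refl

  conv<-stable : ∀ p d → conv< (p ℕ.+ d) (+ p) ≡ conv< p (+ p)
  conv<-stable p d = begin
      conv< (p ℕ.+ d) (+ p)
    ≡⟨ sum<-split p d _ ⟩
      conv< p (+ p) + sum< d (λ k → s (p ℕ.+ k) * extend a (+ p - + (p ℕ.+ k)))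
    ≡⟨ cong (λ x → conv< p (+ p) + x) (sum<-zero d _ vanishes) ⟩
      conv< p (+ p) + + 0
    ≡⟨ ℤP.+-identityʳ _ ⟩
      conv< p (+ p)
    ∎
    where
    cancel : ∀ p k → p - (p + k) ≡ - k
    cancel = solve-∀
    vanishes : ∀ k → s (p ℕ.+ k) * extend a (+ p - + (p ℕ.+ k)) ≡ + 0
    vanishes k = begin
        s (p ℕ.+ k) * extend a (+ p - + (p ℕ.+ k))
      ≡⟨ cong (λ x → s (p ℕ.+ k) * extend a x) (cancel (+ p) (+ k)) ⟩
        s (p ℕ.+ k) * extend a (- + k)
      ≡⟨ cong (s (p ℕ.+ k) *_) (extend-a-nonpositive k) ⟩
        s (p ℕ.+ k) * + 0
      ≡⟨ ℤP.*-zeroʳ (s (p ℕ.+ k)) ⟩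
        + 0
      ∎

  conv<-negative : ∀ n q → conv< n -[1+ q ] ≡ + 0
  conv<-negative n q = sum<-zero n _ λ k →
    trans (cong (λ x → s k * extend a x) (negative-shift q k)) (ℤP.*-zeroʳ (s k))

  W : ℤ → ℤ
  W (+ p)    = s p - conv< p (+ p)
  W -[1+ _ ] = + 0

  conv<≡s-W : ∀ n m → m ℤ.< + n → conv< n m ≡ extend s m - W m
  conv<≡s-W n (+ p) (ℤ.+<+ p<n) = begin
      conv< n (+ p)
    ≡⟨ cong (λ i → conv< i (+ p)) (sym (ℕP.m+[n∸m]≡n (ℕP.<⇒≤ p<n))) ⟩
      conv< (p ℕ.+ (n ∸ p)) (+ p)
    ≡⟨ conv<-stable p (n ∸ p) ⟩
      conv< p (+ p)
    ≡⟨ unfold (s p) (conv< p (+ p)) ⟩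
      s p - (s p - conv< p (+ p))
    ∎
    where
    unfold : ∀ x y → y ≡ x - (x - y)
    unfold = solve-∀
  conv<≡s-W n -[1+ q ] _ = conv<-negative n q

  W-rec : ∀ n → W (+ n) + apply P W (+ n) ≡ δ (+ n) + apply P δ (+ n)
  W-rec n = begin
      s n - conv< n (+ n) + PW
    ≡⟨ cong (λ x → s n - x + PW) conv<-at-n ⟩
      s n - (Ns - (Ps - PW)) + PW
    ≡⟨ rearrange (s n) Ns Ps PW ⟩
      s n + Ps - Ns
    ≡⟨ s-rec (+ n) ⟩
      δ (+ n) + apply P δ (+ n)
    ∎
    where
    PW = apply P W (+ n)
    Ps = apply P (extend s) (+ n)
    Ns = apply N (extend s) (+ n)
    rearrange : ∀ x n p w → x - (n - (p - w)) + w ≡ x + p - n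
    rearrange = solve-∀
    isolate : ∀ {x y z} → x + y ≡ z → x ≡ z - y
    isolate {x} {y} refl = cancel x y
      where
      cancel : ∀ x y → x ≡ x + y - y
      cancel = solve-∀
    -- Causality lets us evaluate both sides of conv<-rec from values below n.
    conv<-at-n : conv< n (+ n) ≡ Ns - (Ps - PW)
    conv<-at-n = trans (isolate (conv<-rec n (+ n)))
      (cong₂ _-_ (apply-causal N n _ _ (convolve-δ n s))
                 (trans (apply-causal P n (conv< n) (λ m → extend s m - W m) (conv<≡s-W n))
                        (apply-− P (extend s) W (+ n))))

  -- By strong induction, W agrees with δ: the causal part P W is already known.
  W≡δ : ∀ p → W (+ p) ≡ δ (+ p)
  W≡δ = <-rec (λ p → W (+ p) ≡ δ (+ p)) step
    where
    cancel : ∀ {w x d y} → w + x ≡ d + y → x ≡ y → w ≡ d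
    cancel {w} {x} {d} w+x≡d+x refl = begin
        w          ≡⟨ add-sub w x ⟩
        w + x - x  ≡⟨ cong (_- x) w+x≡d+x ⟩
        d + x - x  ≡⟨ sym (add-sub d x) ⟩
        d          ∎
      where
      add-sub : ∀ a b → a ≡ a + b - b
      add-sub = solve-∀
    step : ∀ p → (∀ {q} → q < p → W (+ q) ≡ δ (+ q)) → W (+ p) ≡ δ (+ p)
    step p ih = cancel (W-rec p) (apply-causal P p W δ below)
      where
      below : ∀ m → m ℤ.< + p → W m ≡ δ m
      below (+ q)    (ℤ.+<+ q<p) = ih q<p
      below -[1+ _ ] _           = refl

  -- W = δ says s_n = (s⋆a)_n for n ≥ 1; splitting off the k = 0 term (s₀ = 1)
  -- gives the convolution identity in the form used by detTH-closedForm.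
  convolution : ∀ n → s (suc n) ≡ a (suc n) + sum< n (λ k → s (suc k) * a (n ∸ k))
  convolution n = begin
      s (suc n)
    ≡⟨ ℤP.i-j≡0⇒i≡j (s (suc n)) _ (W≡δ (suc n)) ⟩
      s 0 * extend a (+ suc n - + 0) + sum< n (λ k → s (suc k) * extend a (+ suc n - + suc k))
    ≡⟨ cong₂ _+_ first-term
                 (sum<-cong n (λ k k<n → cong (λ i → s (suc k) * extend a i) (minus-≤ (s≤s (ℕP.<⇒≤ k<n))))) ⟩
      a (suc n) + sum< n (λ k → s (suc k) * a (n ∸ k))
    ∎
    where
    first-term : s 0 * extend a (+ suc n - + 0) ≡ a (suc n)
    first-term = trans (cong₂ (λ x i → x * extend a i) s₀≡1 (ℤP.+-identityʳ (+ suc n)))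
                       (ℤP.*-identityˡ (a (suc n)))

-- T and the sequences of the theorem are computed with fuel, and recurse on
-- n ∸ j (j ≥ 1) only at indices n above some bound x; then fuel n + 1 suffices.
fuel-bound : ∀ {x n j f} → x < n → 1 ≤ j → n < suc f → n ∸ j < f
fuel-bound {n = suc n} _ j≥1 (s≤s n<f) = ℕP.≤-<-trans (ℕP.∸-monoʳ-≤ (suc n) j≥1) n<f

-- Combining four instances of the tribonacci recurrence  t = t₁ + t₂ + tᵣ + d
-- (at shifts 0, 1, 2, r) with the signs of 1 + E - E² ± E^r.  The product
-- (1 + E - E² ± E^r)(1 - E - E² - E^r) contains only even powers of E when the
-- sign is (-1)^(r+1); these are the two bisections of the recurrence.
combine-odd : ∀ {t₀ t₁ t₂ t₃ t₄ tᵣ tᵣ₁ tᵣ₂ t₂ᵣ d₀ d₁ d₂ dᵣ : ℤ} →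
  t₀ ≡ t₁ + t₂ + tᵣ + d₀ → t₁ ≡ t₂ + t₃ + tᵣ₁ + d₁ → t₂ ≡ t₃ + t₄ + tᵣ₂ + d₂ →
  tᵣ ≡ tᵣ₁ + tᵣ₂ + t₂ᵣ + dᵣ →
  t₀ ≡ + 3 * t₂ - t₄ + + 2 * tᵣ₁ + t₂ᵣ + (d₀ + d₁ - d₂ + dᵣ)
combine-odd {t₃ = t₃} {t₄ = t₄} {tᵣ₁ = tᵣ₁} {tᵣ₂} {t₂ᵣ} {d₀} {d₁} {d₂} {dᵣ} refl refl refl refl =
  solve (t₃ ∷ t₄ ∷ tᵣ₁ ∷ tᵣ₂ ∷ t₂ᵣ ∷ d₀ ∷ d₁ ∷ d₂ ∷ dᵣ ∷ [])

combine-even : ∀ {t₀ t₁ t₂ t₃ t₄ tᵣ tᵣ₁ tᵣ₂ t₂ᵣ d₀ d₁ d₂ dᵣ : ℤ} →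
  t₀ ≡ t₁ + t₂ + tᵣ + d₀ → t₁ ≡ t₂ + t₃ + tᵣ₁ + d₁ → t₂ ≡ t₃ + t₄ + tᵣ₂ + d₂ →
  tᵣ ≡ tᵣ₁ + tᵣ₂ + t₂ᵣ + dᵣ →
  t₀ ≡ + 3 * t₂ - t₄ + + 2 * tᵣ - + 2 * tᵣ₂ - t₂ᵣ + (d₀ + d₁ - d₂ - dᵣ)
combine-even {t₃ = t₃} {t₄ = t₄} {tᵣ₁ = tᵣ₁} {tᵣ₂} {t₂ᵣ} {d₀} {d₁} {d₂} {dᵣ} refl refl refl refl =
  solve (t₃ ∷ t₄ ∷ tᵣ₁ ∷ tᵣ₂ ∷ t₂ᵣ ∷ d₀ ∷ d₁ ∷ d₂ ∷ dᵣ ∷ [])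

-- The r-tribonacci numbers for r = R + 1 (so that r - 1 = R).
module Tribonacci (R : ℕ) (R≥1 : 1 ≤ R) where

  tribAux-fuel : ∀ f f′ n → n < f → n < f′ → tribAux (suc R) f n ≡ tribAux (suc R) f′ n
  tribAux-fuel (suc f) (suc f′) n n<f n<f′ with n <? R
  ... | yes _ = refl
  ... | no n≮R with n ℕ.≟ R
  ...   | yes _   = refl
  ...   | no n≢R  =
    cong₂ ℕ._+_ (cong₂ ℕ._+_ (tribAux-fuel f f′ (n ∸ 1) (bound n<f) (bound n<f′))
                             (tribAux-fuel f f′ (n ∸ 2) (bound n<f) (bound n<f′)))
                (tribAux-fuel f f′ (n ∸ suc R) (bound n<f) (bound n<f′))
    where
    R<n : R < n
    R<n = ℕP.≤∧≢⇒< (ℕP.≮⇒≥ n≮R) (n≢R ∘ sym)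
    bound : ∀ {g j} → {{_ : ℕ.NonZero j}} → n < suc g → n ∸ j < g
    bound {j = suc j} = fuel-bound R<n (s≤s z≤n)

  T-below : ∀ n → n < R → T (suc R) n ≡ 0
  T-below n n<R with n <? R
  ... | yes _   = refl
  ... | no n≮R = contradiction n<R n≮R

  T-at : T (suc R) R ≡ 1
  T-at with R <? R
  ... | yes R<R = contradiction R<R (ℕP.<-irrefl refl)
  ... | no _ with R ℕ.≟ R
  ...   | yes _   = refl
  ...   | no R≢R = contradiction refl R≢R

  T-rec : ∀ n → R < n → T (suc R) n ≡ T (suc R) (n ∸ 1) ℕ.+ T (suc R) (n ∸ 2) ℕ.+ T (suc R) (n ∸ suc R)
  T-rec (suc n) R<n with suc n <? R
  ... | yes n<R = contradiction R<n (ℕP.<-asym n<R)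
  ... | no _ with suc n ℕ.≟ R
  ...   | yes n≡R = contradiction (sym n≡R) (ℕP.<⇒≢ R<n)
  ...   | no _    =
    cong₂ ℕ._+_ (cong₂ ℕ._+_ (tribAux-fuel (suc n) _ n ℕP.≤-refl ℕP.≤-refl)
                             (tribAux-fuel (suc n) _ (n ∸ 1) (s≤s (ℕP.m∸n≤m n 1)) ℕP.≤-refl))
                (tribAux-fuel (suc n) _ (n ∸ R) (s≤s (ℕP.m∸n≤m n R)) ℕP.≤-refl)

  +T-below : ∀ n → n < R → + T (suc R) n ≡ + 0
  +T-below n n<R = cong +_ (T-below n n<R)

  -- The recurrence at natural indices, with the initial value 1 at R as a δ term.
  T-rec-δ : ∀ n → + T (suc R) n
    ≡ + T (suc R) (n ∸ 1) + + T (suc R) (n ∸ 2) + + T (suc R) (n ∸ suc R) + δ (+ n - + R)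
  T-rec-δ n with ℕP.<-cmp n R
  ... | tri< n<R n≢R _ = trans (+T-below n n<R) (sym (cong₂ _+_
          (cong₂ _+_ (cong₂ _+_ (+T-below (n ∸ 1) (below 1)) (+T-below (n ∸ 2) (below 2)))
                     (+T-below (n ∸ suc R) (below (suc R))))
          (δ-minus-≢ n R n≢R)))
    where
    below : ∀ j → n ∸ j < R
    below j = ℕP.≤-<-trans (ℕP.m∸n≤m n j) n<R
  ... | tri≈ _ refl _ = trans (cong +_ T-at) (sym (cong₂ _+_
          (cong₂ _+_ (cong₂ _+_ (+T-below (R ∸ 1) (fuel-bound R≥1 (s≤s z≤n) ℕP.≤-refl))
                                (+T-below (R ∸ 2) (fuel-bound R≥1 (s≤s z≤n) ℕP.≤-refl)))
                     (trans (cong (λ i → + T (suc R) i) (ℕP.m≤n⇒m∸n≡0 (ℕP.n≤1+n R))) (+T-below 0 R≥1)))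
          (δ-minus-self R)))
  ... | tri> _ n≢R R<n = begin
      + T (suc R) n            ≡⟨ cong +_ (T-rec n R<n) ⟩
      earlier                  ≡⟨ sym (ℤP.+-identityʳ earlier) ⟩
      earlier + + 0            ≡⟨ cong (λ d → earlier + d) (sym (δ-minus-≢ n R n≢R)) ⟩
      earlier + δ (+ n - + R)  ∎
    where
    earlier = + T (suc R) (n ∸ 1) + + T (suc R) (n ∸ 2) + + T (suc R) (n ∸ suc R)

  t : ℤ → ℤ
  t = extend (λ n → + T (suc R) n)

  t-rec : ∀ y → t y ≡ t (y - + 1) + t (y - + 2) + t (y - + suc R) + δ (y - + R)
  t-rec (+ n) = begin
      + T (suc R) n
    ≡⟨ T-rec-δ n ⟩
      + T (suc R) (n ∸ 1) + + T (suc R) (n ∸ 2) + + T (suc R) (n ∸ suc R) + δ (+ n - + R)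
    ≡⟨ cong (_+ δ (+ n - + R)) (sym (cong₂ _+_ (cong₂ _+_ (at 1) (at 2)) (at (suc R)))) ⟩
      t (+ n - + 1) + t (+ n - + 2) + t (+ n - + suc R) + δ (+ n - + R)
    ∎
    where
    at : ∀ j → t (+ n - + j) ≡ + T (suc R) (n ∸ j)
    at = extend-minus (λ n → + T (suc R) n) (+T-below 0 R≥1) n
  t-rec -[1+ k ] = sym (cong (λ d → + 0 + + 0 + + 0 + d) (cong δ (negative-shift k R)))

  t-rec-at : ∀ x k → t (x - + k)
    ≡ t (x - + (k ℕ.+ 1)) + t (x - + (k ℕ.+ 2)) + t (x - + (k ℕ.+ suc R)) + δ (x - + (k ℕ.+ R))
  t-rec-at x k = begin
      t (x - + k)
    ≡⟨ t-rec (x - + k) ⟩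
      t (x - + k - + 1) + t (x - + k - + 2) + t (x - + k - + suc R) + δ (x - + k - + R)
    ≡⟨ cong₂ _+_ (cong₂ _+_ (cong₂ _+_ (cong t (minus-minus x k 1)) (cong t (minus-minus x k 2)))
                            (cong t (minus-minus x k (suc R))))
                 (cong δ (minus-minus x k R)) ⟩
      t (x - + (k ℕ.+ 1)) + t (x - + (k ℕ.+ 2)) + t (x - + (k ℕ.+ suc R)) + δ (x - + (k ℕ.+ R))
    ∎

  -- The instance at x - r, with the shifts normalised to those of t-rec-at x 1, 2.
  t-rec-far : ∀ x → t (x - + suc R)
    ≡ t (x - + suc (suc R)) + t (x - + suc (suc (suc R))) + t (x - + (suc R ℕ.+ suc R))
      + δ (x - + (suc R ℕ.+ R))
  t-rec-far x = subst₂ (λ i j → t (x - + suc R) ≡ t (x - + i) + t (x - + j) + t (x - + (suc R ℕ.+ suc R))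
                                                  + δ (x - + (suc R ℕ.+ R)))
    (ℕP.+-comm (suc R) 1) (ℕP.+-comm (suc R) 2) (t-rec-at x (suc R))

  t-bisect-odd : ∀ x → t x
    ≡ + 3 * t (x - + 2) - t (x - + 4) + + 2 * t (x - + suc (suc R)) + t (x - + (suc R ℕ.+ suc R))
      + (δ (x - + R) + δ (x - + suc R) - δ (x - + suc (suc R)) + δ (x - + (suc R ℕ.+ R)))
  t-bisect-odd x = combine-odd (t-rec x) (t-rec-at x 1) (t-rec-at x 2) (t-rec-far x)

  t-bisect-even : ∀ x → t x
    ≡ + 3 * t (x - + 2) - t (x - + 4) + + 2 * t (x - + suc R) - + 2 * t (x - + suc (suc (suc R)))
      - t (x - + (suc R ℕ.+ suc R))
      + (δ (x - + R) + δ (x - + suc R) - δ (x - + suc (suc R)) - δ (x - + (suc R ℕ.+ R)))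
  t-bisect-even x = combine-even (t-rec x) (t-rec-at x 1) (t-rec-at x 2) (t-rec-far x)

  oddTrib-bisection : ∀ y → extend (oddTribSeq (suc R)) y ≡ t (y + y - + 1) + δ y
  oddTrib-bisection (+ zero)  = refl
  oddTrib-bisection (+ suc k) = trans (cong (λ i → + T (suc R) i) 2k+1≡k+[1+k]) (sym (ℤP.+-identityʳ _))
    where
    2k+1≡k+[1+k] : 2 ℕ.* k ℕ.+ 1 ≡ k ℕ.+ suc k
    2k+1≡k+[1+k] = trans (ℕP.+-comm (2 ℕ.* k) 1)
                    (trans (cong (λ i → suc (k ℕ.+ i)) (ℕP.+-identityʳ k)) (sym (ℕP.+-suc k k)))
  oddTrib-bisection -[1+ k ] = refl

  oddTrib-shift : ∀ m j → extend (oddTribSeq (suc R)) (m - + j) ≡ t (m + m - + 1 - + (j ℕ.+ j)) + δ (m - + j)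
  oddTrib-shift m j = trans (oddTrib-bisection (m - + j)) (cong (λ i → t i + δ (m - + j)) (regroup m (+ j)))
    where
    regroup : ∀ m j → (m - j) + (m - j) - + 1 ≡ m + m - + 1 - (j + j)
    regroup = solve-∀

-- The recurrence of s = (1; T₁, T₃, …).  Its values are s(m - j) = t(2m - 1 - 2j)
-- + δ(m - j), and the δ terms of the bisected recurrence are evaluated by parity.

δ-odd : ∀ y → δ (y + y - + 1) ≡ + 0
δ-odd (+ zero)  = refl
δ-odd (+ suc n) = cong (λ i → δ (+ i)) (ℕP.+-suc n n)
δ-odd -[1+ n ]  = refl

δ-even : ∀ y → δ (y + y) ≡ δ y
δ-even (+ zero)  = refl
δ-even (+ suc n) = refl
δ-even -[1+ n ]  = refl

δ-odd-shift : ∀ m j → δ (m + m - + 1 - + (j ℕ.+ j)) ≡ + 0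
δ-odd-shift m j = trans (cong δ (regroup m (+ j))) (δ-odd (m - + j))
  where
  regroup : ∀ m j → m + m - + 1 - (j + j) ≡ (m - j) + (m - j) - + 1
  regroup = solve-∀

δ-even-shift : ∀ m j → δ (m + m - + 1 - + suc (j ℕ.+ j)) ≡ δ (m - + suc j)
δ-even-shift m j = trans (cong δ (regroup m (+ j))) (δ-even (m - + suc j))
  where
  regroup : ∀ m j → m + m - + 1 - (+ 1 + (j + j)) ≡ (m - (+ 1 + j)) + (m - (+ 1 + j))
  regroup = solve-∀

assemble-odd : ∀ {S₀ S₁ S₂ Sₕ Sᵣ t₀ t₂ t₄ tₕ t₂ᵣ e₀ e₁ e₂ eₕ eᵣ d₀ d₁ d₂ dᵣ : ℤ} →
  S₀ ≡ t₀ + e₀ → S₁ ≡ t₂ + e₁ → S₂ ≡ t₄ + e₂ → Sₕ ≡ tₕ + eₕ → Sᵣ ≡ t₂ᵣ + eᵣ →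
  t₀ ≡ + 3 * t₂ - t₄ + + 2 * tₕ + t₂ᵣ + (d₀ + d₁ - d₂ + dᵣ) →
  d₀ ≡ + 0 → d₁ ≡ eₕ → d₂ ≡ + 0 → dᵣ ≡ eᵣ →
  S₀ + (- + 3 * S₁ + (+ 1 * S₂ + (- + 1 * Sₕ + + 0))) - (+ 1 * Sₕ + (+ 1 * Sᵣ + + 0))
    ≡ e₀ + (- + 3 * e₁ + (+ 1 * e₂ + (- + 1 * eₕ + + 0)))
assemble-odd {t₂ = t₂} {t₄} {tₕ} {t₂ᵣ} {e₀} {e₁} {e₂} {eₕ} {eᵣ}
  refl refl refl refl refl refl refl refl refl refl =
  solve (t₂ ∷ t₄ ∷ tₕ ∷ t₂ᵣ ∷ e₀ ∷ e₁ ∷ e₂ ∷ eₕ ∷ eᵣ ∷ [])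

assemble-even : ∀ {S₀ S₁ S₂ Sₕ Sₕ₁ Sᵣ t₀ t₂ t₄ tₕ tₕ₁ t₂ᵣ e₀ e₁ e₂ eₕ eₕ₁ eᵣ d₀ d₁ d₂ dᵣ : ℤ} →
  S₀ ≡ t₀ + e₀ → S₁ ≡ t₂ + e₁ → S₂ ≡ t₄ + e₂ → Sₕ ≡ tₕ + eₕ → Sₕ₁ ≡ tₕ₁ + eₕ₁ → Sᵣ ≡ t₂ᵣ + eᵣ →
  t₀ ≡ + 3 * t₂ - t₄ + + 2 * tₕ - + 2 * tₕ₁ - t₂ᵣ + (d₀ + d₁ - d₂ - dᵣ) →
  d₀ ≡ eₕ → d₁ ≡ + 0 → d₂ ≡ eₕ₁ → dᵣ ≡ eᵣ →
  S₀ + (- + 3 * S₁ + (+ 1 * S₂ + (- + 1 * Sₕ + (+ 1 * Sₕ₁ + + 0))))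
    - (+ 1 * Sₕ + (- + 1 * Sₕ₁ + (- + 1 * Sᵣ + + 0)))
    ≡ e₀ + (- + 3 * e₁ + (+ 1 * e₂ + (- + 1 * eₕ + (+ 1 * eₕ₁ + + 0))))
assemble-even {t₂ = t₂} {t₄} {tₕ} {tₕ₁} {t₂ᵣ} {e₀} {e₁} {e₂} {eₕ} {eₕ₁} {eᵣ}
  refl refl refl refl refl refl refl refl refl refl refl =
  solve (t₂ ∷ t₄ ∷ tₕ ∷ tₕ₁ ∷ t₂ᵣ ∷ e₀ ∷ e₁ ∷ e₂ ∷ eₕ ∷ eₕ₁ ∷ eᵣ ∷ [])

-- r = 2q + 1 odd, h = q + 1.  With P = -3x + x² - x^h and N = x^h + x^r the
-- generating function S of (1; T₁, T₃, …) satisfies (1 + P - N) S = 1 + P.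
module OddSequence (q : ℕ) (q≥1 : 1 ≤ q) where
  R : ℕ
  R = q ℕ.+ q
  open Tribonacci R (ℕP.≤-trans q≥1 (ℕP.m≤m+n q q))

  P N : Operator
  P = (- + 3 , 0) ∷ (+ 1 , 1) ∷ (- + 1 , q) ∷ []
  N = (+ 1 , q) ∷ (+ 1 , R) ∷ []

  s-rec : ∀ m → let ŝ = extend (oddTribSeq (suc R)) in
    ŝ m + apply P ŝ m - apply N ŝ m ≡ δ m + apply P δ m
  s-rec m = assemble-odd {t₂ = t (x - + 2)} {e₁ = δ (m - + 1)}
    (oddTrib-bisection m) (oddTrib-shift m 1) (oddTrib-shift m 2)
    (subst (λ i → ŝ (m - + suc q) ≡ t (x - + i) + δ (m - + suc q)) 2[1+q]≡2+R (oddTrib-shift m (suc q)))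
    (oddTrib-shift m (suc R))
    (t-bisect-odd x)
    (δ-odd-shift m q) (δ-even-shift m q)
    (subst (λ i → δ (x - + i) ≡ + 0) 2[1+q]≡2+R (δ-odd-shift m (suc q)))
    (δ-even-shift m R)
    where
    ŝ = extend (oddTribSeq (suc R))
    x = m + m - + 1
    2[1+q]≡2+R : suc q ℕ.+ suc q ≡ suc (suc R)
    2[1+q]≡2+R = cong suc (ℕP.+-suc q q)

-- r = 2h even, h = g + 1.  With P = -3x + x² - x^h + x^(h+1) and
-- N = x^h - x^(h+1) - x^r again (1 + P - N) S = 1 + P.
module EvenSequence (g : ℕ) (g≥1 : 1 ≤ g) where
  R : ℕ
  R = g ℕ.+ suc g
  open Tribonacci R (ℕP.≤-trans g≥1 (ℕP.m≤m+n g (suc g)))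

  P N : Operator
  P = (- + 3 , 0) ∷ (+ 1 , 1) ∷ (- + 1 , g) ∷ (+ 1 , suc g) ∷ []
  N = (+ 1 , g) ∷ (- + 1 , suc g) ∷ (- + 1 , R) ∷ []

  s-rec : ∀ m → let ŝ = extend (oddTribSeq (suc R)) in
    ŝ m + apply P ŝ m - apply N ŝ m ≡ δ m + apply P δ m
  s-rec m = assemble-even {t₂ = t (x - + 2)} {t₄ = t (x - + 4)} {e₁ = δ (m - + 1)} {e₂ = δ (m - + 2)}
    (oddTrib-bisection m) (oddTrib-shift m 1) (oddTrib-shift m 2)
    (oddTrib-shift m (suc g))
    (subst (λ i → ŝ (m - + suc (suc g)) ≡ t (x - + i) + δ (m - + suc (suc g))) 2[2+g]≡3+R
           (oddTrib-shift m (suc (suc g))))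
    (oddTrib-shift m (suc R))
    (t-bisect-even x)
    (subst (λ i → δ (x - + i) ≡ δ (m - + suc g)) (sym (ℕP.+-suc g g)) (δ-even-shift m g))
    (δ-odd-shift m (suc g)) (δ-even-shift m (suc g))
    (δ-even-shift m R)
    where
    ŝ = extend (oddTribSeq (suc R))
    x = m + m - + 1
    2[2+g]≡3+R : suc (suc g) ℕ.+ suc (suc g) ≡ suc (suc (suc R))
    2[2+g]≡3+R = cong (λ i → ℕ.suc (ℕ.suc i)) (ℕP.+-suc g (suc g))

fib-skip : ∀ k → + fib (suc (suc (suc (suc k)))) ≡ + 3 * + fib (suc (suc k)) - + fib k
fib-skip k = identity (+ fib (suc k)) (+ fib k)
  where
  identity : ∀ x y → x + y + x + (x + y) ≡ + 3 * (x + y) - y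
  identity = solve-∀

fibEven fibOdd : ℕ → ℤ
fibEven j = + fib (j ℕ.+ j)
fibOdd  j = + fib (suc (j ℕ.+ j))

double-suc : ∀ j → suc j ℕ.+ suc j ≡ suc (suc (j ℕ.+ j))
double-suc j = cong suc (ℕP.+-suc j j)

fibEven-rec : ∀ j → fibEven (suc (suc j)) ≡ + 3 * fibEven (suc j) - fibEven j
fibEven-rec j = begin
    + fib (suc (suc j) ℕ.+ suc (suc j))
  ≡⟨ cong (λ i → + fib i) (trans (double-suc (suc j)) (cong (λ i → ℕ.suc (ℕ.suc i)) (double-suc j))) ⟩
    + fib (suc (suc (suc (suc (j ℕ.+ j)))))
  ≡⟨ fib-skip (j ℕ.+ j) ⟩
    + 3 * + fib (suc (suc (j ℕ.+ j))) - fibEven j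
  ≡⟨ cong (λ i → + 3 * + fib i - fibEven j) (sym (double-suc j)) ⟩
    + 3 * fibEven (suc j) - fibEven j
  ∎

fibEven-rec′ : ∀ p → 1 ≤ p → fibEven (suc p) ≡ + 3 * fibEven p - fibEven (ℕ.pred p)
fibEven-rec′ (suc p) _ = fibEven-rec p

fibOdd-rec : ∀ j → fibOdd (suc (suc j)) ≡ + 3 * fibOdd (suc j) - fibOdd j
fibOdd-rec j = begin
    + fib (suc (suc (suc j) ℕ.+ suc (suc j)))
  ≡⟨ cong (λ i → + fib (suc i)) (trans (double-suc (suc j)) (cong (λ i → ℕ.suc (ℕ.suc i)) (double-suc j))) ⟩
    + fib (suc (suc (suc (suc (suc (j ℕ.+ j))))))
  ≡⟨ fib-skip (suc (j ℕ.+ j)) ⟩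
    + 3 * + fib (suc (suc (suc (j ℕ.+ j)))) - fibOdd j
  ≡⟨ cong (λ i → + 3 * + fib (suc i) - fibOdd j) (sym (double-suc j)) ⟩
    + 3 * fibOdd (suc j) - fibOdd j
  ∎

-- r = 2q + 1 odd (q ≥ 1), h = q + 1, a = aSeq r.  In terms of the operators
-- P = -3x + x² - x^h and N = x^h + x^r of OddSequence, (1 + P) A = N.
module OddRecurrence (q : ℕ) (q≥1 : 1 ≤ q) where
  r : ℕ
  r = suc (q ℕ.+ q)

  a : ℕ → ℤ
  a = aSeq r

  open OddSequence q q≥1 using (P; N)

  h≡1+q : (r ℕ.+ 1) / 2 ≡ suc q
  h≡1+q = trans (cong (_/ 2) (r+1≡[1+q]*2 q)) (m*n/n≡m (suc q) 2)
    where
    r+1≡[1+q]*2 : ∀ q → suc (q ℕ.+ q) ℕ.+ 1 ≡ suc q ℕ.* 2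
    r+1≡[1+q]*2 = ℕ-Solver.solve-∀

  -- In particular the recursion steps n ∸ h of the definition are positive.
  1≤h : 1 ≤ (r ℕ.+ 1) / 2
  1≤h = subst (1 ≤_) (sym h≡1+q) (s≤s z≤n)

  q<r : q < r
  q<r = s≤s (ℕP.m≤m+n q q)

  1+q<r : suc q < r
  1+q<r = s≤s (ℕP.m<m+n q q≥1)

  aAux-fuel : ∀ f f′ n → n < f → n < f′ → aAux r f n ≡ aAux r f′ n
  aAux-fuel (suc f) (suc f′) n n<f n<f′ with n <? (r ℕ.+ 1) / 2
  ... | yes _ = refl
  ... | no _ with n <? r
  ...   | yes _ = refl
  ...   | no n≮r with n ℕ.≟ r
  ...     | yes _  = refl
  ...     | no n≢r =
    cong₂ _+_ (cong₂ _-_ (cong (+ 3 *_) (aAux-fuel f f′ (n ∸ 1) (bound 1≤1 n<f) (bound 1≤1 n<f′)))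
                         (aAux-fuel f f′ (n ∸ 2) (bound 1≤2 n<f) (bound 1≤2 n<f′)))
              (aAux-fuel f f′ (n ∸ (r ℕ.+ 1) / 2) (bound 1≤h n<f) (bound 1≤h n<f′))
    where
    1≤1 : 1 ≤ 1
    1≤1 = s≤s z≤n
    1≤2 : 1 ≤ 2
    1≤2 = s≤s z≤n
    bound : ∀ {g j} → 1 ≤ j → n < suc g → n ∸ j < g
    bound = fuel-bound (ℕP.≤∧≢⇒< (ℕP.≮⇒≥ n≮r) (n≢r ∘ sym))

  a-low : ∀ n → n ≤ q → a n ≡ + 0
  a-low n n≤q with n <? (r ℕ.+ 1) / 2
  ... | yes _   = refl
  ... | no n≮h = contradiction (subst (n <_) (sym h≡1+q) (s≤s n≤q)) n≮h

  a-mid : ∀ j → j ≤ q → a (q ℕ.+ j) ≡ fibEven j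
  a-mid zero    _   = a-low (q ℕ.+ 0) (ℕP.≤-reflexive (ℕP.+-identityʳ q))
  a-mid (suc j) j<q with q ℕ.+ suc j <? (r ℕ.+ 1) / 2
  ... | yes n<h = contradiction (subst (q ℕ.+ suc j <_) h≡1+q n<h)
                                (ℕP.≤⇒≯ (subst (suc q ≤_) (sym (ℕP.+-suc q j)) (s≤s (ℕP.m≤m+n q j))))
  ... | no _ with q ℕ.+ suc j <? r
  ...   | no n≮r = contradiction (s≤s (ℕP.+-monoʳ-≤ q j<q)) n≮r
  ...   | yes _  = cong (λ i → + fib i) index
    where
    double : ∀ q j → 2 ℕ.* (q ℕ.+ suc j) ≡ suc (q ℕ.+ q) ℕ.+ (j ℕ.+ suc j)
    double = ℕ-Solver.solve-∀
    index : 2 ℕ.* (q ℕ.+ suc j) ∸ r ℕ.+ 1 ≡ suc j ℕ.+ suc j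
    index = begin
        2 ℕ.* (q ℕ.+ suc j) ∸ r ℕ.+ 1       ≡⟨ cong (λ i → i ∸ r ℕ.+ 1) (double q j) ⟩
        r ℕ.+ (j ℕ.+ suc j) ∸ r ℕ.+ 1       ≡⟨ cong (ℕ._+ 1) (ℕP.m+n∸m≡n r (j ℕ.+ suc j)) ⟩
        j ℕ.+ suc j ℕ.+ 1                   ≡⟨ ℕP.+-comm (j ℕ.+ suc j) 1 ⟩
        suc j ℕ.+ suc j                     ∎

  a-at-r : a r ≡ + 1 + fibEven (suc q)
  a-at-r with r <? (r ℕ.+ 1) / 2
  ... | yes r<h = contradiction (subst (r <_) h≡1+q r<h) (ℕP.≤⇒≯ q<r)
  ... | no _ with r <? r
  ...   | yes r<r = contradiction r<r (ℕP.<-irrefl refl)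
  ...   | no _ with r ℕ.≟ r
  ...     | no r≢r = contradiction refl r≢r
  ...     | yes _  = cong (λ i → + 1 + + fib i) (trans (ℕP.+-comm r 1) (sym (double-suc q)))

  a-high : ∀ n → r < n → a n ≡ + 3 * a (n ∸ 1) - a (n ∸ 2) + a (n ∸ suc q)
  a-high (suc n) r<n with suc n <? (r ℕ.+ 1) / 2
  ... | yes n<h = contradiction (ℕP.<-trans r<n (ℕP.<-≤-trans (subst (suc n <_) h≡1+q n<h) q<r))
                                (ℕP.<-irrefl refl)
  ... | no _ with suc n <? r
  ...   | yes n<r = contradiction r<n (ℕP.<-asym n<r)
  ...   | no _ with suc n ℕ.≟ r
  ...     | yes n≡r = contradiction (sym n≡r) (ℕP.<⇒≢ r<n)
  ...     | no _    =
    cong₂ _+_ (cong₂ _-_ (cong (+ 3 *_) (aAux-fuel (suc n) _ n ℕP.≤-refl ℕP.≤-refl))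
                         (aAux-fuel (suc n) _ (n ∸ 1) (s≤s (ℕP.m∸n≤m n 1)) ℕP.≤-refl))
              (trans (aAux-fuel (suc n) (suc (suc n ∸ (r ℕ.+ 1) / 2)) (suc n ∸ (r ℕ.+ 1) / 2)
                                (fuel-bound (s≤s z≤n) 1≤h ℕP.≤-refl) ℕP.≤-refl)
                     (cong (λ h → a (suc n ∸ h)) h≡1+q))

  -- The shape of (1 + P) a = N δ at one index, as produced by `apply`.
  Shape : (x₀ x₁ x₂ xₕ dₕ dᵣ : ℤ) → Set
  Shape x₀ x₁ x₂ xₕ dₕ dᵣ =
    x₀ + (- + 3 * x₁ + (+ 1 * x₂ + (- + 1 * xₕ + + 0))) ≡ + 1 * dₕ + (+ 1 * dᵣ + + 0)

  Shape-subst : ∀ {x₀ x₁ x₂ xₕ dₕ dᵣ y₀ y₁ y₂ yₕ eₕ eᵣ} →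
    x₀ ≡ y₀ → x₁ ≡ y₁ → x₂ ≡ y₂ → xₕ ≡ yₕ → dₕ ≡ eₕ → dᵣ ≡ eᵣ →
    Shape y₀ y₁ y₂ yₕ eₕ eᵣ → Shape x₀ x₁ x₂ xₕ dₕ dᵣ
  Shape-subst refl refl refl refl refl refl holds = holds

  Rec : ℕ → Set
  Rec n = Shape (a n) (a (n ∸ 1)) (a (n ∸ 2)) (a (n ∸ suc q)) (δ (+ n - + suc q)) (δ (+ n - + r))

  rec-low : ∀ n → n ≤ q → Rec n
  rec-low n n≤q = Shape-subst (a-low n n≤q) (a-low (n ∸ 1) (below 1)) (a-low (n ∸ 2) (below 2))
    (a-low (n ∸ suc q) (below (suc q)))
    (δ-minus-≢ n (suc q) (ℕP.<⇒≢ (s≤s n≤q))) (δ-minus-≢ n r (ℕP.<⇒≢ (ℕP.≤-<-trans n≤q q<r))) refl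
    where
    below : ∀ j → n ∸ j ≤ q
    below j = ℕP.≤-trans (ℕP.m∸n≤m n j) n≤q

  mid-minus-1 : ∀ j → q ℕ.+ suc j ∸ 1 ≡ q ℕ.+ j
  mid-minus-1 j = cong (_∸ 1) (ℕP.+-suc q j)

  mid-minus-2 : ∀ j → q ℕ.+ suc j ∸ 2 ≡ q ℕ.+ j ∸ 1
  mid-minus-2 j = trans (sym (ℕP.∸-+-assoc (q ℕ.+ suc j) 1 1)) (cong (_∸ 1) (mid-minus-1 j))

  mid-minus-h : ∀ j → q ℕ.+ suc j ∸ suc q ≡ j
  mid-minus-h j = trans (cong (_∸ suc q) (ℕP.+-suc q j)) (ℕP.m+n∸m≡n q j)

  -- At h = q + 1 the term x^h of N starts the sequence: a_h = F₂ = 1.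
  rec-h : Rec (q ℕ.+ 1)
  rec-h = Shape-subst (a-mid 1 q≥1) (trans (cong a (mid-minus-1 0)) (a-mid 0 z≤n))
    (trans (cong a (mid-minus-2 0))
           (a-low (q ℕ.+ 0 ∸ 1) (ℕP.≤-trans (ℕP.m∸n≤m (q ℕ.+ 0) 1) (ℕP.≤-reflexive (ℕP.+-identityʳ q)))))
    (trans (cong a (mid-minus-h 0)) (a-low 0 z≤n))
    (trans (cong (λ n → δ (+ n - + suc q)) (ℕP.+-comm q 1)) (δ-minus-self (suc q)))
    (δ-minus-≢ (q ℕ.+ 1) r (ℕP.<⇒≢ (subst (_< r) (ℕP.+-comm 1 q) 1+q<r)))
    refl

  -- Strictly between h and r: the Fibonacci recurrence F_{2j+4} = 3F_{2j+2} - F_{2j}.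
  rec-mid : ∀ j → suc (suc j) ≤ q → Rec (q ℕ.+ suc (suc j))
  rec-mid j 2+j≤q = Shape-subst
    (trans (a-mid (suc (suc j)) 2+j≤q) (fibEven-rec j))
    (trans (cong a (mid-minus-1 (suc j))) (a-mid (suc j) (ℕP.<⇒≤ 2+j≤q)))
    (trans (cong a (trans (mid-minus-2 (suc j)) (mid-minus-1 j)))
           (a-mid j (ℕP.≤-trans (ℕP.n≤1+n j) (ℕP.<⇒≤ 2+j≤q))))
    (trans (cong a (mid-minus-h (suc j))) (a-low (suc j) (ℕP.<⇒≤ 2+j≤q)))
    (δ-minus-≢ _ (suc q) (≢-h j))
    (δ-minus-≢ _ r (ℕP.<⇒≢ (s≤s (ℕP.+-monoʳ-≤ q 2+j≤q))))
    (cancel (fibEven (suc j)) (fibEven j))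
    where
    ≢-h : ∀ j → q ℕ.+ suc (suc j) ≢ suc q
    ≢-h j e = ℕP.m≢1+m+n q (sym (trans (sym (ℕP.+-suc q j))
                                       (ℕP.suc-injective (trans (sym (ℕP.+-suc q (suc j))) e))))
    cancel : ∀ x y → (+ 3 * x - y) + (- + 3 * x + (+ 1 * y + (- + 1 * + 0 + + 0)))
                     ≡ + 1 * + 0 + (+ 1 * + 0 + + 0)
    cancel = solve-∀

  -- At r the term x^r of N contributes: a_r = 1 + F_{2q+2}.
  rec-r : Rec r
  rec-r = Shape-subst
    (trans a-at-r (cong (λ x → + 1 + x) (fibEven-rec′ q q≥1)))
    (a-mid q ℕP.≤-refl)
    (trans (cong a (double-pred q q≥1)) (a-mid (ℕ.pred q) ℕP.pred[n]≤n))
    (trans (cong a (ℕP.m+n∸m≡n q q)) (a-low q ℕP.≤-refl))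
    (δ-minus-≢ r (suc q) (≢-sym (ℕP.<⇒≢ 1+q<r)))
    (δ-minus-self r)
    (cancel (fibEven q) (fibEven (ℕ.pred q)))
    where
    double-pred : ∀ p → 1 ≤ p → p ℕ.+ p ∸ 1 ≡ p ℕ.+ ℕ.pred p
    double-pred (suc p) _ = ℕP.+-suc p p
    cancel : ∀ x y → (+ 1 + (+ 3 * x - y)) + (- + 3 * x + (+ 1 * y + (- + 1 * + 0 + + 0)))
                     ≡ + 1 * + 0 + (+ 1 * + 1 + + 0)
    cancel = solve-∀

  -- Above r the defining recurrence of a is exactly (1 + P) a = 0.
  rec-high : ∀ n → r < n → Rec n
  rec-high n r<n = Shape-subst {y₁ = a (n ∸ 1)} {a (n ∸ 2)} {a (n ∸ suc q)} (a-high n r<n) refl refl refl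
    (δ-minus-≢ n (suc q) (≢-sym (ℕP.<⇒≢ (ℕP.<-trans 1+q<r r<n))))
    (δ-minus-≢ n r (≢-sym (ℕP.<⇒≢ r<n)))
    (cancel (a (n ∸ 1)) (a (n ∸ 2)) (a (n ∸ suc q)))
    where
    cancel : ∀ x y z → (+ 3 * x - y + z) + (- + 3 * x + (+ 1 * y + (- + 1 * z + + 0)))
                       ≡ + 1 * + 0 + (+ 1 * + 0 + + 0)
    cancel = solve-∀

  rec-above : ∀ j → Rec (q ℕ.+ suc j)
  rec-above zero = rec-h
  rec-above (suc j) with ℕP.<-cmp (suc j) q
  ... | tri< 1+j<q _ _   = rec-mid j 1+j<q
  ... | tri≈ _ 1+j≡q _   = subst Rec (trans (sym (ℕP.+-suc q q)) (cong (λ i → q ℕ.+ suc i) (sym 1+j≡q))) rec-r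
  ... | tri> _ _ q<1+j   = rec-high (q ℕ.+ suc (suc j))
                             (subst (r <_) (sym (ℕP.+-suc q (suc j))) (s≤s (ℕP.+-monoʳ-< q q<1+j)))

  rec : ∀ n → Rec n
  rec n with n ≤? q
  ... | yes n≤q = rec-low n n≤q
  ... | no  n≰q =
    subst Rec (trans (ℕP.+-suc q (n ∸ suc q)) (ℕP.m+[n∸m]≡n (ℕP.≰⇒> n≰q))) (rec-above (n ∸ suc q))

  a₀≡0 : a 0 ≡ + 0
  a₀≡0 = a-low 0 z≤n

  a-rec : ∀ m → extend a m + apply P (extend a) m ≡ apply N δ m
  a-rec (+ n) =
    Shape-subst {x₀ = a n} {extend a (+ n - + 1)} {extend a (+ n - + 2)} {extend a (+ n - + suc q)}
                {δ (+ n - + suc q)} {δ (+ n - + r)}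
                refl (extend-minus a a₀≡0 n 1) (extend-minus a a₀≡0 n 2) (extend-minus a a₀≡0 n (suc q))
                refl refl (rec n)
  a-rec -[1+ k ] = refl

-- r = 2h even, h = g + 1 (g ≥ 1), b = bSeq r.  With the operators
-- P = -3x + x² - x^h + x^(h+1) and N = x^h - x^(h+1) - x^r, (1 + P) B = N.
module EvenRecurrence (g : ℕ) (g≥1 : 1 ≤ g) where
  r : ℕ
  r = suc g ℕ.+ suc g

  b : ℕ → ℤ
  b = bSeq r

  open EvenSequence g g≥1 using (P; N)

  h≡1+g : r / 2 ≡ suc g
  h≡1+g = trans (cong (_/ 2) (r≡[1+g]*2 g)) (m*n/n≡m (suc g) 2)
    where
    r≡[1+g]*2 : ∀ g → suc g ℕ.+ suc g ≡ suc g ℕ.* 2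
    r≡[1+g]*2 = ℕ-Solver.solve-∀

  -- In particular the recursion steps n ∸ h of the definition are positive.
  1≤h : 1 ≤ r / 2
  1≤h = subst (1 ≤_) (sym h≡1+g) (s≤s z≤n)

  h<r : suc g < r
  h<r = s≤s (ℕP.m<m+n g (s≤s z≤n))

  bAux-fuel : ∀ f f′ n → n < f → n < f′ → bAux r f n ≡ bAux r f′ n
  bAux-fuel (suc f) (suc f′) n n<f n<f′ with n <? r / 2
  ... | yes _ = refl
  ... | no _ with n ≤? r
  ...   | yes _  = refl
  ...   | no n≰r =
    cong₂ _-_ (cong₂ _+_ (cong₂ _-_ (cong (+ 3 *_) (bAux-fuel f f′ (n ∸ 1) (bound 1≤1 n<f) (bound 1≤1 n<f′)))
                                    (bAux-fuel f f′ (n ∸ 2) (bound 1≤2 n<f) (bound 1≤2 n<f′)))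
                         (bAux-fuel f f′ (n ∸ r / 2) (bound 1≤h n<f) (bound 1≤h n<f′)))
              (bAux-fuel f f′ (n ∸ r / 2 ∸ 1) (bound-h1 n<f) (bound-h1 n<f′))
    where
    1≤1 : 1 ≤ 1
    1≤1 = s≤s z≤n
    1≤2 : 1 ≤ 2
    1≤2 = s≤s z≤n
    bound : ∀ {f j} → 1 ≤ j → n < suc f → n ∸ j < f
    bound = fuel-bound (ℕP.≰⇒> n≰r)
    bound-h1 : ∀ {f} → n < suc f → n ∸ r / 2 ∸ 1 < f
    bound-h1 n<f = ℕP.≤-<-trans (ℕP.m∸n≤m (n ∸ r / 2) 1) (bound 1≤h n<f)

  b-low : ∀ n → n ≤ g → b n ≡ + 0
  b-low n n≤g with n <? r / 2
  ... | yes _   = refl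
  ... | no n≮h = contradiction (subst (n <_) (sym h≡1+g) (s≤s n≤g)) n≮h

  b-mid : ∀ i → i ≤ suc g → b (suc g ℕ.+ i) ≡ fibOdd i
  b-mid i i≤h with suc g ℕ.+ i <? r / 2
  ... | yes n<h = contradiction (subst (suc g ℕ.+ i <_) h≡1+g n<h) (ℕP.≤⇒≯ (ℕP.m≤m+n (suc g) i))
  ... | no _ with suc g ℕ.+ i ≤? r
  ...   | no n≰r = contradiction (ℕP.+-monoʳ-≤ (suc g) i≤h) n≰r
  ...   | yes _  = cong (λ i → + fib i) index
    where
    double : ∀ g i → 2 ℕ.* (suc g ℕ.+ i) ≡ suc g ℕ.+ suc g ℕ.+ (i ℕ.+ i)
    double = ℕ-Solver.solve-∀
    index : 2 ℕ.* (suc g ℕ.+ i) ∸ r ℕ.+ 1 ≡ suc (i ℕ.+ i)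
    index = begin
        2 ℕ.* (suc g ℕ.+ i) ∸ r ℕ.+ 1    ≡⟨ cong (λ n → n ∸ r ℕ.+ 1) (double g i) ⟩
        r ℕ.+ (i ℕ.+ i) ∸ r ℕ.+ 1        ≡⟨ cong (ℕ._+ 1) (ℕP.m+n∸m≡n r (i ℕ.+ i)) ⟩
        i ℕ.+ i ℕ.+ 1                    ≡⟨ ℕP.+-comm (i ℕ.+ i) 1 ⟩
        suc (i ℕ.+ i)                    ∎

  b-high : ∀ n → r < n → b n ≡ + 3 * b (n ∸ 1) - b (n ∸ 2) + b (n ∸ suc g) - b (n ∸ suc (suc g))
  b-high (suc n) r<n with suc n <? r / 2
  ... | yes n<h = contradiction (ℕP.<-trans r<n (ℕP.<-trans (subst (suc n <_) h≡1+g n<h) h<r))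
                                (ℕP.<-irrefl refl)
  ... | no _ with suc n ≤? r
  ...   | yes n≤r = contradiction n≤r (ℕP.<⇒≱ r<n)
  ...   | no _    =
    cong₂ _-_ (cong₂ _+_ (cong₂ _-_ (cong (+ 3 *_) (bAux-fuel (suc n) _ n ℕP.≤-refl ℕP.≤-refl))
                                    (bAux-fuel (suc n) _ (n ∸ 1) (s≤s (ℕP.m∸n≤m n 1)) ℕP.≤-refl))
                         (trans (bAux-fuel (suc n) (suc (suc n ∸ r / 2)) (suc n ∸ r / 2) below-h ℕP.≤-refl)
                                (cong (λ h → b (suc n ∸ h)) h≡1+g)))
              (trans (bAux-fuel (suc n) (suc (suc n ∸ r / 2 ∸ 1)) (suc n ∸ r / 2 ∸ 1)
                                (ℕP.≤-<-trans (ℕP.m∸n≤m (suc n ∸ r / 2) 1) below-h) ℕP.≤-refl)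
                     (cong b (trans (cong (λ h → suc n ∸ h ∸ 1) h≡1+g)
                                    (trans (ℕP.∸-+-assoc (suc n) (suc g) 1)
                                           (cong (suc n ∸_) (ℕP.+-comm (suc g) 1))))))
    where
    below-h : suc n ∸ r / 2 < suc n
    below-h = fuel-bound (s≤s z≤n) 1≤h ℕP.≤-refl

  -- The shape of (1 + P) b = N δ at one index, as produced by `apply`.
  Shape : (x₀ x₁ x₂ xₕ xₕ₁ dₕ dₕ₁ dᵣ : ℤ) → Set
  Shape x₀ x₁ x₂ xₕ xₕ₁ dₕ dₕ₁ dᵣ =
    x₀ + (- + 3 * x₁ + (+ 1 * x₂ + (- + 1 * xₕ + (+ 1 * xₕ₁ + + 0))))
      ≡ + 1 * dₕ + (- + 1 * dₕ₁ + (- + 1 * dᵣ + + 0))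

  Shape-subst : ∀ {x₀ x₁ x₂ xₕ xₕ₁ dₕ dₕ₁ dᵣ y₀ y₁ y₂ yₕ yₕ₁ eₕ eₕ₁ eᵣ} →
    x₀ ≡ y₀ → x₁ ≡ y₁ → x₂ ≡ y₂ → xₕ ≡ yₕ → xₕ₁ ≡ yₕ₁ → dₕ ≡ eₕ → dₕ₁ ≡ eₕ₁ → dᵣ ≡ eᵣ →
    Shape y₀ y₁ y₂ yₕ yₕ₁ eₕ eₕ₁ eᵣ → Shape x₀ x₁ x₂ xₕ xₕ₁ dₕ dₕ₁ dᵣ
  Shape-subst refl refl refl refl refl refl refl refl holds = holds

  Rec : ℕ → Set
  Rec n = Shape (b n) (b (n ∸ 1)) (b (n ∸ 2)) (b (n ∸ suc g)) (b (n ∸ suc (suc g)))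
                (δ (+ n - + suc g)) (δ (+ n - + suc (suc g))) (δ (+ n - + r))

  rec-low : ∀ n → n ≤ g → Rec n
  rec-low n n≤g = Shape-subst (b-low n n≤g) (b-low (n ∸ 1) (below 1)) (b-low (n ∸ 2) (below 2))
    (b-low (n ∸ suc g) (below (suc g))) (b-low (n ∸ suc (suc g)) (below (suc (suc g))))
    (δ-minus-≢ n (suc g) (ℕP.<⇒≢ (s≤s n≤g)))
    (δ-minus-≢ n (suc (suc g)) (ℕP.<⇒≢ (s≤s (ℕP.m≤n⇒m≤1+n n≤g))))
    (δ-minus-≢ n r (ℕP.<⇒≢ (ℕP.<-trans (s≤s n≤g) h<r))) refl
    where
    below : ∀ j → n ∸ j ≤ g
    below j = ℕP.≤-trans (ℕP.m∸n≤m n j) n≤g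

  up-minus-1 : ∀ i → suc g ℕ.+ suc i ∸ 1 ≡ suc g ℕ.+ i
  up-minus-1 i = ℕP.+-suc g i

  up-minus-2 : ∀ i → suc g ℕ.+ suc (suc i) ∸ 2 ≡ suc g ℕ.+ i
  up-minus-2 i = trans (cong (_∸ 1) (ℕP.+-suc g (suc i))) (ℕP.+-suc g i)

  up-minus-h : ∀ i → suc g ℕ.+ i ∸ suc g ≡ i
  up-minus-h i = ℕP.m+n∸m≡n (suc g) i

  up-minus-h1 : ∀ i → suc g ℕ.+ suc i ∸ suc (suc g) ≡ i
  up-minus-h1 i = trans (cong (_∸ suc g) (ℕP.+-suc g i)) (ℕP.m+n∸m≡n g i)

  -- At h the term x^h of N starts the sequence: b_h = F₁ = 1.
  rec-h : Rec (suc g ℕ.+ 0)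
  rec-h = Shape-subst (b-mid 0 z≤n) (b-low (g ℕ.+ 0) g+0≤g)
    (b-low (g ℕ.+ 0 ∸ 1) (ℕP.≤-trans (ℕP.m∸n≤m (g ℕ.+ 0) 1) g+0≤g))
    (trans (cong b (up-minus-h 0)) (b-low 0 z≤n))
    (trans (cong b (ℕP.m≤n⇒m∸n≡0 (ℕP.m≤n⇒m≤1+n g+0≤g))) (b-low 0 z≤n))
    (trans (cong (λ n → δ (+ n - + suc g)) (ℕP.+-identityʳ (suc g))) (δ-minus-self (suc g)))
    (δ-minus-≢ (suc g ℕ.+ 0) (suc (suc g)) (ℕP.<⇒≢ (s≤s (s≤s g+0≤g))))
    (δ-minus-≢ (suc g ℕ.+ 0) r (ℕP.<⇒≢ (subst (_< r) (sym (ℕP.+-identityʳ (suc g))) h<r)))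
    refl
    where
    g+0≤g : g ℕ.+ 0 ≤ g
    g+0≤g = ℕP.≤-reflexive (ℕP.+-identityʳ g)

  -- At h + 1 the term -x^(h+1) of N contributes: b_{h+1} = F₃ = 2 = 3 b_h - 1.
  rec-h1 : Rec (suc g ℕ.+ 1)
  rec-h1 = Shape-subst (b-mid 1 (s≤s z≤n)) (trans (cong b (up-minus-1 0)) (b-mid 0 z≤n))
    (trans (cong b (cong (_∸ 1) (ℕP.+-suc g 0))) (b-low (g ℕ.+ 0) (ℕP.≤-reflexive (ℕP.+-identityʳ g))))
    (trans (cong b (up-minus-h 1)) (b-low 1 g≥1))
    (trans (cong b (up-minus-h1 0)) (b-low 0 z≤n))
    (δ-minus-≢ (suc g ℕ.+ 1) (suc g) (≢-sym (ℕP.<⇒≢ (subst (suc g <_) (ℕP.+-comm 1 (suc g)) ℕP.≤-refl))))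
    (trans (cong (λ n → δ (+ n - + suc (suc g))) (ℕP.+-comm (suc g) 1)) (δ-minus-self (suc (suc g))))
    (δ-minus-≢ (suc g ℕ.+ 1) r (ℕP.<⇒≢ (ℕP.+-monoʳ-< (suc g) (s≤s g≥1))))
    refl

  -- For h + 2 ≤ n ≤ r the term b_{n-h} is nonzero only at n = r, exactly
  -- where the term -x^r of N contributes.
  b-h-vs-r : ∀ i → suc (suc i) ≤ suc g → δ (+ (suc g ℕ.+ suc (suc i)) - + r) ≡ b (suc (suc i))
  b-h-vs-r i 2+i≤h with suc (suc i) ≤? g
  ... | yes 2+i≤g = trans (δ-minus-≢ _ r (ℕP.<⇒≢ (ℕP.+-monoʳ-< (suc g) (s≤s 2+i≤g))))
                          (sym (b-low (suc (suc i)) 2+i≤g))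
  ... | no  2+i≰g = trans (cong (λ i → δ (+ (suc g ℕ.+ i) - + r)) 2+i≡h)
                          (trans (δ-minus-self r)
                                 (sym (trans (cong b (trans 2+i≡h (sym (ℕP.+-identityʳ (suc g)))))
                                             (b-mid 0 z≤n))))
    where
    2+i≡h : suc (suc i) ≡ suc g
    2+i≡h = ℕP.≤-antisym 2+i≤h (ℕP.≰⇒> 2+i≰g)

  -- Between h + 2 and r: the Fibonacci recurrence F_{2i+5} = 3F_{2i+3} - F_{2i+1}.
  rec-mid : ∀ i → suc (suc i) ≤ suc g → Rec (suc g ℕ.+ suc (suc i))
  rec-mid i 2+i≤h = Shape-subst {yₕ = b (suc (suc i))}
    (trans (b-mid (suc (suc i)) 2+i≤h) (fibOdd-rec i))
    (trans (cong b (up-minus-1 (suc i))) (b-mid (suc i) (ℕP.≤-trans (ℕP.n≤1+n (suc i)) 2+i≤h)))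
    (trans (cong b (up-minus-2 i)) (b-mid i (ℕP.≤-trans (ℕP.n≤1+n i) (ℕP.≤-trans (ℕP.n≤1+n (suc i)) 2+i≤h))))
    (cong b (up-minus-h (suc (suc i))))
    (trans (cong b (up-minus-h1 (suc i))) (b-low (suc i) (ℕP.≤-pred 2+i≤h)))
    (δ-minus-≢ (suc g ℕ.+ suc (suc i)) (suc g) (≢-sym (ℕP.<⇒≢ (ℕP.m<m+n (suc g) (s≤s z≤n)))))
    (δ-minus-≢ (suc g ℕ.+ suc (suc i)) (suc (suc g))
               (≢-sym (ℕP.<⇒≢ (subst (suc (suc g) <_) (sym (ℕP.+-suc (suc g) (suc i)))
                                     (s≤s (ℕP.m<m+n (suc g) (s≤s z≤n)))))))
    (b-h-vs-r i 2+i≤h)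
    (cancel (fibOdd (suc i)) (fibOdd i) (b (suc (suc i))))
    where
    cancel : ∀ x y v → (+ 3 * x - y) + (- + 3 * x + (+ 1 * y + (- + 1 * v + (+ 1 * + 0 + + 0))))
                       ≡ + 1 * + 0 + (- + 1 * + 0 + (- + 1 * v + + 0))
    cancel = solve-∀

  -- Above r the defining recurrence of b is exactly (1 + P) b = 0.
  rec-high : ∀ n → r < n → Rec n
  rec-high n r<n = Shape-subst {y₁ = b (n ∸ 1)} {b (n ∸ 2)} {b (n ∸ suc g)} {b (n ∸ suc (suc g))}
    (b-high n r<n) refl refl refl refl
    (δ-minus-≢ n (suc g) (≢-sym (ℕP.<⇒≢ (ℕP.<-trans h<r r<n))))
    (δ-minus-≢ n (suc (suc g)) (≢-sym (ℕP.<⇒≢ (ℕP.≤-<-trans h<r r<n))))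
    (δ-minus-≢ n r (≢-sym (ℕP.<⇒≢ r<n)))
    (cancel (b (n ∸ 1)) (b (n ∸ 2)) (b (n ∸ suc g)) (b (n ∸ suc (suc g))))
    where
    cancel : ∀ x y z w → (+ 3 * x - y + z - w) + (- + 3 * x + (+ 1 * y + (- + 1 * z + (+ 1 * w + + 0))))
                         ≡ + 1 * + 0 + (- + 1 * + 0 + (- + 1 * + 0 + + 0))
    cancel = solve-∀

  rec-above : ∀ i → Rec (suc g ℕ.+ i)
  rec-above zero          = rec-h
  rec-above (suc zero)    = rec-h1
  rec-above (suc (suc i)) with suc (suc i) ≤? suc g
  ... | yes 2+i≤h = rec-mid i 2+i≤h
  ... | no  2+i≰h = rec-high (suc g ℕ.+ suc (suc i)) (ℕP.+-monoʳ-< (suc g) (ℕP.≰⇒> 2+i≰h))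

  rec : ∀ n → Rec n
  rec n with n ≤? g
  ... | yes n≤g = rec-low n n≤g
  ... | no  n≰g = subst Rec (ℕP.m+[n∸m]≡n (ℕP.≰⇒> n≰g)) (rec-above (n ∸ suc g))

  b₀≡0 : b 0 ≡ + 0
  b₀≡0 = b-low 0 z≤n

  b-rec : ∀ m → extend b m + apply P (extend b) m ≡ apply N δ m
  b-rec (+ n) =
    Shape-subst {x₀ = b n} {extend b (+ n - + 1)} {extend b (+ n - + 2)} {extend b (+ n - + suc g)}
                {extend b (+ n - + suc (suc g))} {δ (+ n - + suc g)} {δ (+ n - + suc (suc g))} {δ (+ n - + r)}
                refl (extend-minus b b₀≡0 n 1) (extend-minus b b₀≡0 n 2) (extend-minus b b₀≡0 n (suc g))
                (extend-minus b b₀≡0 n (suc (suc g))) refl refl refl (rec n)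
  b-rec -[1+ k ] = refl

twice : ∀ k → k ℕ.* 2 ≡ k ℕ.+ k
twice = ℕ-Solver.solve-∀

odd-shape : ∀ r → 3 ≤ r → r % 2 ≡ 1 → ∃[ q ] 1 ≤ q × r ≡ suc (q ℕ.+ q)
odd-shape r 3≤r r%2≡1 =
  from-quotient (r / 2) (trans (m≡m%n+[m/n]*n r 2) (cong (ℕ._+ r / 2 ℕ.* 2) r%2≡1))
  where
  from-quotient : ∀ k → r ≡ 1 ℕ.+ k ℕ.* 2 → ∃[ q ] 1 ≤ q × r ≡ suc (q ℕ.+ q)
  from-quotient zero    r≡1    = contradiction (subst (3 ≤_) r≡1 3≤r) λ { (s≤s ()) }
  from-quotient (suc q) r≡1+2k = suc q , s≤s z≤n , trans r≡1+2k (cong suc (twice (suc q)))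

even-shape : ∀ r → 3 ≤ r → r % 2 ≡ 0 → ∃[ g ] 1 ≤ g × r ≡ suc g ℕ.+ suc g
even-shape r 3≤r r%2≡0 =
  from-quotient (r / 2) (trans (m≡m%n+[m/n]*n r 2) (cong (ℕ._+ r / 2 ℕ.* 2) r%2≡0))
  where
  from-quotient : ∀ k → r ≡ 0 ℕ.+ k ℕ.* 2 → ∃[ g ] 1 ≤ g × r ≡ suc g ℕ.+ suc g
  from-quotient zero          r≡0  = contradiction (subst (3 ≤_) r≡0 3≤r) λ ()
  from-quotient (suc zero)    r≡2  = contradiction (subst (3 ≤_) r≡2 3≤r) λ { (s≤s (s≤s ())) }
  from-quotient (suc (suc g)) r≡2k = suc g , s≤s z≤n , trans r≡2k (twice (suc (suc g)))

closed-form-odd : ∀ q → 1 ≤ q → ∀ n → 1 ≤ n →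
  detTH n (oddTribSeq (suc (q ℕ.+ q))) ≡ sgn (n ∸ 1) * aSeq (suc (q ℕ.+ q)) n
closed-form-odd q 1≤q (suc m) _ =
  detTH-closedForm s a refl (InverseSeries.convolution s a refl a₀≡0 P N a-rec s-rec) m
  where
  open OddSequence q 1≤q using (P; N; s-rec)
  open OddRecurrence q 1≤q using (a; a₀≡0; a-rec)
  s = oddTribSeq (suc (q ℕ.+ q))

closed-form-even : ∀ g → 1 ≤ g → ∀ n → 1 ≤ n →
  detTH n (oddTribSeq (suc g ℕ.+ suc g)) ≡ sgn (n ∸ 1) * bSeq (suc g ℕ.+ suc g) n
closed-form-even g 1≤g (suc m) _ =
  detTH-closedForm s b refl (InverseSeries.convolution s b refl b₀≡0 P N b-rec s-rec) m
  where
  open EvenSequence g 1≤g using (P; N; s-rec)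
  open EvenRecurrence g 1≤g using (b; b₀≡0; b-rec)
  s = oddTribSeq (suc g ℕ.+ suc g)

theorem7 : ∀ (r n : ℕ) → 3 ≤ r → 1 ≤ n →
    (r % 2 ≡ 1 → detTH n (oddTribSeq r) ≡ ((- + 1) ^ (n ∸ 1)) * aSeq r n)
    × (r % 2 ≡ 0 → detTH n (oddTribSeq r) ≡ ((- + 1) ^ (n ∸ 1)) * bSeq r n)
theorem7 r n 3≤r 1≤n = odd-case , even-case
  where
  odd-case : r % 2 ≡ 1 → detTH n (oddTribSeq r) ≡ ((- + 1) ^ (n ∸ 1)) * aSeq r n
  odd-case r%2≡1 with odd-shape r 3≤r r%2≡1
  ... | q , 1≤q , refl = closed-form-odd q 1≤q n 1≤n
  even-case : r % 2 ≡ 0 → detTH n (oddTribSeq r) ≡ ((- + 1) ^ (n ∸ 1)) * bSeq r n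
  even-case r%2≡0 with even-shape r 3≤r r%2≡0
  ... | g , 1≤g , refl = closed-form-even g 1≤g n 1≤n
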